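{- For $n \ge 1$ and complex numbers $b\neq 0$, $c \neq 0$, we have \[ A_n(x;b)=x\sum_{m=0}^{n-1}\sum_{l_1+\cdots+l_n=m}\sum_{k=0}^{n-1}\sum_{j=0}^{k}\binom{n-1}{m}\binom{m}{l_1,\ldots,l_n}\binom{k}{j}\left(\prod_{i=1}^{n}a_{l_i}^{(-b)}(-c)\right)\frac{(-1)^j(nc)^k}{k!}(x+j)^{n-1-m}, \] where the sum over $l_1+\cdots+l_n=m$ runs over $n$-tuples of nonnegative integers.
   Context: The Abel polynomials are $A_n(x;b)=x(x-bn)^{n-1}$. The actuarial polynomials $a_l^{(\beta)}(x)$ are defined by the generating function $\sum_{l\ge0}a_l^{(\beta)}(x)\frac{t^l}{l!}=e^{\beta t+x(1-e^t)}$. $\binom{m}{l_1,\ldots,l_n}$ denotes the multinomial coefficient. -}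

module Defs where

open import Level using (Level; _⊔_)
open import Algebra.Bundles using (CommutativeRing)
open import Data.Nat as ℕ using (ℕ; zero; suc; _∸_; _!)
open import Data.Nat.Combinatorics using (_C_)
open import Data.Vec as Vec using (Vec; []; _∷_)
open import Data.List as List using (List; []; _∷_; concatMap; upTo)
open import Relation.Nullary using (¬_)

module RingOps {c ℓ : Level} (R : CommutativeRing c ℓ) where
  open CommutativeRing R

  natCast : ℕ → Carrier
  natCast zero    = 0#
  natCast (suc n) = 1# + natCast n

  pow : Carrier → ℕ → Carrier
  pow x zero    = 1#
  pow x (suc n) = x * pow x n

  sumBelow : ℕ → (ℕ → Carrier) → Carrier
  sumBelow zero    f = 0#
  sumBelow (suc n) f = sumBelow n f + f n

  sumUpTo : ℕ → (ℕ → Carrier) → Carrier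
  sumUpTo n f = sumBelow (suc n) f

  sumList : {A : Set} → List A → (A → Carrier) → Carrier
  sumList []       f = 0#
  sumList (a ∷ as) f = f a + sumList as f

  prodVec : {A : Set} {n : ℕ} → Vec A n → (A → Carrier) → Carrier
  prodVec []       f = 1#
  prodVec (a ∷ as) f = f a * prodVec as f

tuples : (n m : ℕ) → List (Vec ℕ n)
tuples zero    zero    = [] ∷ []
tuples zero    (suc m) = []
tuples (suc n) m       =
  concatMap (λ l → List.map (l ∷_) (tuples n (m ∸ l))) (upTo (suc m))

-- A commutative ring that is a field of characteristic zero,
-- with the inverse given as a total operation (x ⁻¹ meaningful for x ≉ 0).
record IsCharZeroField {c ℓ : Level} (R : CommutativeRing c ℓ) : Set (c ⊔ ℓ) where
  open CommutativeRing R
  open RingOps R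
  field
    _⁻¹      : Carrier → Carrier
    inverseʳ : ∀ x → ¬ (x ≈ 0#) → x * (x ⁻¹) ≈ 1#
    nontrivial : ¬ (1# ≈ 0#)
    charZero : ∀ n → ¬ (natCast (suc n) ≈ 0#)

module FieldOps {c ℓ : Level} (R : CommutativeRing c ℓ) (F : IsCharZeroField R) where
  open CommutativeRing R
  open RingOps R public
  open IsCharZeroField F

  -- formal power series, given by their (ordinary) coefficient sequences
  Series : Set c
  Series = ℕ → Carrier

  δ₀ : Series
  δ₀ zero    = 1#
  δ₀ (suc _) = 0#

  tS : Series
  tS 1 = 1#
  tS _ = 0#

  mulS : Series → Series → Series
  mulS f g n = sumUpTo n (λ i → f i * g (n ∸ i))

  powS : Series → ℕ → Series
  powS g zero    = δ₀
  powS g (suc k) = mulS g (powS g k)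

  -- exp(g) = Σ_k g^k / k!  for a series g with zero constant term
  -- (the coefficient of t^n only receives contributions from k ≤ n)
  expS : Series → Series
  expS g n = sumUpTo n (λ k → ((natCast (k !)) ⁻¹) * powS g k n)

  eT : Series
  eT n = (natCast (n !)) ⁻¹

  actuarialExponent : Carrier → Carrier → Series
  actuarialExponent β x n = β * tS n + x * (δ₀ n - eT n)

  -- actuarial polynomials:  Σ_l a_l^{(β)}(x) t^l / l! = exp(β t + x (1 - e^t))
  actuarial : ℕ → Carrier → Carrier → Carrier
  actuarial l β x = natCast (l !) * expS (actuarialExponent β x) l

  abel : ℕ → Carrier → Carrier → Carrier
  abel n x b = x * pow (x - b * natCast n) (n ∸ 1)

  multinomial : ℕ → {n : ℕ} → Vec ℕ n → Carrier
  multinomial m ls = natCast (m !) * (prodVec ls (λ l → natCast (l !)) ⁻¹)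

  binom : ℕ → ℕ → Carrier
  binom a b = natCast (a C b)

  theorem3RHS : ℕ → Carrier → Carrier → Carrier → Carrier
  theorem3RHS n x b c =
    x * sumBelow n (λ m →
          sumList (tuples n m) (λ ls →
            sumBelow n (λ k →
              sumUpTo k (λ j →
                binom (n ∸ 1) m * multinomial m ls * binom k j
                * prodVec ls (λ l → actuarial l (- b) (- c))
                * (pow (- 1#) j * pow (natCast n * c) k * ((natCast (k !)) ⁻¹))
                * pow (x + natCast j) ((n ∸ 1) ∸ m)))))

module Submission where

open import Defs
open import Level using (Level)
open import Algebra.Bundles using (CommutativeRing)
open import Data.Nat as ℕ using (ℕ; zero; suc; _∸_; _!; z≤n; s≤s; _≤_; _<_)
import Data.Nat.Properties as NP
open import Data.Nat.Combinatorics using (_C_; k![n∸k]!∣n!)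
open import Data.Nat.Combinatorics.Specification using (nCk≡n!/k![n-k]!)
open import Data.Nat.DivMod using (m/n*n≡m)
open import Data.Fin using (toℕ)
open import Data.List as List using (List; []; _∷_; concatMap; upTo)
open import Data.Vec using (Vec; []; _∷_)
open import Data.Product using (_,_)
open import Data.Sum using (inj₁; inj₂)
open import Data.Maybe using (nothing)
open import Function using (_∘_)
open import Relation.Nullary using (¬_; yes; no)
open import Relation.Binary.PropositionalEquality as P using (_≡_)

-- Put N = n - 1 and y = n c, and work in the ring of formal power series.  Let
-- E = -b t - c (1 - e^t), so that exp E = Σ_l a_l^{(-b)}(-c) t^l / l!.  Since
--   n E + y (1 - e^t) + x t = (x - b n) t,
-- the law exp(f + g) = exp f · exp g gives
--   (exp E)^n · exp(y (1 - e^t)) · e^{x t} = e^{(x - b n) t}.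
-- Multiplying N! [t^N] of both sides by x, the right side is A_n(x;b).  On the
-- left, N! [t^N] of a product is Σ_m C(N,m) (m! [t^m] ·) ((N-m)! [t^{N-m}] ·);
-- the multinomial theorem turns m! [t^m] (exp E)^n into the sum over tuples
-- (l₁,…,lₙ), and expanding (1 - e^t)^k and (x + j)^{N-m} binomially turns
-- (N-m)! [t^{N-m}] exp(y (1 - e^t)) e^{x t} into the double sum over (k, j).

choose-factorials : ∀ {n k} → k ≤ n → (n C k) ℕ.* (k ! ℕ.* (n ∸ k) !) ≡ n !
choose-factorials {n} {k} k≤n =
  P.trans (P.cong (ℕ._* (k ! ℕ.* (n ∸ k) !)) (nCk≡n!/k![n-k]! k≤n))
          (m/n*n≡m (k![n∸k]!∣n! k≤n))
  where instance _ = NP._!*_!≢0 k (n ∸ k)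

-- Finite sums, the image of ℕ, powers and the binomial theorem in an
-- arbitrary commutative ring.  Used both for the base field and for the
-- ring of formal power series over it.
module RingFacts {c ℓ : Level} (S : CommutativeRing c ℓ) where
  open CommutativeRing S
  open RingOps S
  open import Relation.Binary.Reasoning.Setoid setoid
  open import Algebra.Solver.Ring.NaturalCoefficients commutativeSemiring (λ _ _ → nothing)
    using (solve; _:+_; _:=_)
  open import Algebra.Properties.Semiring.Exp semiring using (_^_; ^-congˡ)
  open import Algebra.Properties.Semiring.Mult semiring using (_×_; ×-congʳ; ×-assoc-*; ×1-homo-*)
  open import Algebra.Properties.Monoid.Sum +-monoid using (sum)
  import Algebra.Properties.CommutativeSemiring.Binomial commutativeSemiring as Binomial

  ≡⇒≈ : ∀ {a b} → a ≡ b → a ≈ b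
  ≡⇒≈ P.refl = refl

  Σ-cong : ∀ n {f g : ℕ → Carrier} → (∀ i → i < n → f i ≈ g i) → sumBelow n f ≈ sumBelow n g
  Σ-cong zero    h = refl
  Σ-cong (suc n) h = +-cong (Σ-cong n (λ i i<n → h i (NP.m<n⇒m<1+n i<n))) (h n NP.≤-refl)

  Σ-cong′ : ∀ n {f g : ℕ → Carrier} → (∀ i → f i ≈ g i) → sumBelow n f ≈ sumBelow n g
  Σ-cong′ n h = Σ-cong n (λ i _ → h i)

  Σ-zero : ∀ n {f : ℕ → Carrier} → (∀ i → i < n → f i ≈ 0#) → sumBelow n f ≈ 0#
  Σ-zero n h = trans (Σ-cong n h) (zeros n)
    where
    zeros : ∀ n → sumBelow n (λ _ → 0#) ≈ 0#
    zeros zero    = refl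
    zeros (suc n) = trans (+-identityʳ _) (zeros n)

  Σ-+ : ∀ n (f g : ℕ → Carrier) → sumBelow n (λ i → f i + g i) ≈ sumBelow n f + sumBelow n g
  Σ-+ zero    f g = sym (+-identityˡ 0#)
  Σ-+ (suc n) f g = begin
    sumBelow n (λ i → f i + g i) + (f n + g n)  ≈⟨ +-cong (Σ-+ n f g) refl ⟩
    (sumBelow n f + sumBelow n g) + (f n + g n) ≈⟨ solve 4 (λ a b c d → (a :+ b) :+ (c :+ d) := (a :+ c) :+ (b :+ d)) refl _ _ _ _ ⟩
    (sumBelow n f + f n) + (sumBelow n g + g n) ∎

  Σ-*ˡ : ∀ n a (f : ℕ → Carrier) → a * sumBelow n f ≈ sumBelow n (λ i → a * f i)
  Σ-*ˡ zero    a f = zeroʳ a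
  Σ-*ˡ (suc n) a f = trans (distribˡ a _ _) (+-cong (Σ-*ˡ n a f) refl)

  Σ-*ʳ : ∀ n a (f : ℕ → Carrier) → sumBelow n f * a ≈ sumBelow n (λ i → f i * a)
  Σ-*ʳ zero    a f = zeroˡ a
  Σ-*ʳ (suc n) a f = trans (distribʳ a _ _) (+-cong (Σ-*ʳ n a f) refl)

  Σ-*-Σ : ∀ n m (f g : ℕ → Carrier) →
          sumBelow n f * sumBelow m g ≈ sumBelow n (λ i → sumBelow m (λ j → f i * g j))
  Σ-*-Σ n m f g = trans (Σ-*ʳ n _ f) (Σ-cong′ n (λ i → Σ-*ˡ m (f i) g))

  Σ-first : ∀ n (f : ℕ → Carrier) → sumBelow (suc n) f ≈ f 0 + sumBelow n (f ∘ suc)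
  Σ-first zero    f = trans (+-identityˡ _) (sym (+-identityʳ _))
  Σ-first (suc n) f = trans (+-cong (Σ-first n f) refl) (+-assoc _ _ _)

  Σ-extend : ∀ n M {f : ℕ → Carrier} → n ≤ M → (∀ i → n ≤ i → i < M → f i ≈ 0#) →
             sumBelow M f ≈ sumBelow n f
  Σ-extend n zero    z≤n  h = refl
  Σ-extend n (suc M) n≤sM h with NP.m≤n⇒m<n∨m≡n n≤sM
  ... | inj₂ P.refl = refl
  ... | inj₁ n<sM   =
    trans (+-cong (Σ-extend n M (NP.≤-pred n<sM) (λ i n≤i i<M → h i n≤i (NP.m<n⇒m<1+n i<M)))
                  (h M (NP.≤-pred n<sM) NP.≤-refl))
          (+-identityʳ _)

  Σ-swap : ∀ n m (f : ℕ → ℕ → Carrier) →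
           sumBelow n (λ i → sumBelow m (f i)) ≈ sumBelow m (λ j → sumBelow n (λ i → f i j))
  Σ-swap zero    m f = sym (Σ-zero m (λ _ _ → refl))
  Σ-swap (suc n) m f = trans (+-cong (Σ-swap n m f) refl) (sym (Σ-+ m _ _))

  Σ-reverse : ∀ n (f : ℕ → Carrier) → sumBelow (suc n) f ≈ sumBelow (suc n) (λ i → f (n ∸ i))
  Σ-reverse zero    f = refl
  Σ-reverse (suc n) f = begin
    sumBelow (suc (suc n)) f                         ≈⟨ Σ-first (suc n) f ⟩
    f 0 + sumBelow (suc n) (f ∘ suc)                 ≈⟨ +-comm _ _ ⟩
    sumBelow (suc n) (f ∘ suc) + f 0                 ≈⟨ +-cong (Σ-reverse n (f ∘ suc)) refl ⟩
    sumBelow (suc n) (λ i → f (suc (n ∸ i))) + f 0   ≈⟨ +-cong (Σ-cong (suc n) shift) (≡⇒≈ (P.cong f (P.sym (NP.n∸n≡0 n)))) ⟩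
    sumBelow (suc n) (λ i → f (suc n ∸ i)) + f (suc n ∸ suc n) ∎
    where
    shift : ∀ i → i < suc n → f (suc (n ∸ i)) ≈ f (suc n ∸ i)
    shift i i<sn = ≡⇒≈ (P.cong f (P.sym (NP.+-∸-assoc 1 (NP.≤-pred i<sn))))

  Σ-triangle : ∀ n (f : ℕ → ℕ → Carrier) →
    sumBelow (suc n) (λ k → sumBelow (suc k) (λ i → f i k)) ≈
    sumBelow (suc n) (λ i → sumBelow (suc (n ∸ i)) (λ j → f i (i ℕ.+ j)))
  Σ-triangle zero    f = refl
  Σ-triangle (suc n) f = begin
    sumBelow (suc n) (λ k → sumBelow (suc k) (λ i → f i k)) + sumBelow (suc (suc n)) (λ i → f i (suc n))
      ≈⟨ +-cong (Σ-triangle n f) refl ⟩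
    sumBelow (suc n) (row n) + (sumBelow (suc n) (λ i → f i (suc n)) + f (suc n) (suc n))
      ≈⟨ sym (+-assoc _ _ _) ⟩
    (sumBelow (suc n) (row n) + sumBelow (suc n) (λ i → f i (suc n))) + f (suc n) (suc n)
      ≈⟨ +-cong (sym (Σ-+ (suc n) _ _)) last-row ⟩
    sumBelow (suc n) (λ i → row n i + f i (suc n)) + row (suc n) (suc n)
      ≈⟨ +-cong (Σ-cong (suc n) extend-row) refl ⟩
    sumBelow (suc n) (row (suc n)) + row (suc n) (suc n) ∎
    where
    row : ℕ → ℕ → Carrier
    row n i = sumBelow (suc (n ∸ i)) (λ j → f i (i ℕ.+ j))
    last-row : f (suc n) (suc n) ≈ row (suc n) (suc n)
    last-row rewrite NP.n∸n≡0 n | NP.+-identityʳ n = sym (+-identityˡ _)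
    extend-row : ∀ i → i < suc n → row n i + f i (suc n) ≈ row (suc n) i
    extend-row i i<sn = begin
      row n i + f i (suc n)
        ≈⟨ +-cong refl (≡⇒≈ (P.cong (f i) (P.sym i+[1+n-i]≡1+n))) ⟩
      sumBelow (suc (suc (n ∸ i))) (λ j → f i (i ℕ.+ j))
        ≡⟨ P.cong (λ m → sumBelow (suc m) (λ j → f i (i ℕ.+ j))) (P.sym (NP.+-∸-assoc 1 (NP.≤-pred i<sn))) ⟩
      row (suc n) i ∎
      where
      i+[1+n-i]≡1+n : i ℕ.+ suc (n ∸ i) ≡ suc n
      i+[1+n-i]≡1+n = P.trans (NP.+-suc i (n ∸ i)) (P.cong suc (NP.m+[n∸m]≡n (NP.≤-pred i<sn)))

  ΣL-++ : ∀ {A : Set} (xs ys : List A) (f : A → Carrier) →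
          sumList (xs List.++ ys) f ≈ sumList xs f + sumList ys f
  ΣL-++ []       ys f = sym (+-identityˡ _)
  ΣL-++ (x ∷ xs) ys f = trans (+-cong refl (ΣL-++ xs ys f)) (sym (+-assoc _ _ _))

  ΣL-map : ∀ {A B : Set} (g : A → B) (xs : List A) (f : B → Carrier) →
           sumList (List.map g xs) f ≈ sumList xs (f ∘ g)
  ΣL-map g []       f = refl
  ΣL-map g (x ∷ xs) f = +-cong refl (ΣL-map g xs f)

  ΣL-concatMap : ∀ {A B : Set} (g : A → List B) (xs : List A) (f : B → Carrier) →
                 sumList (concatMap g xs) f ≈ sumList xs (λ a → sumList (g a) f)
  ΣL-concatMap g []       f = refl
  ΣL-concatMap g (x ∷ xs) f = trans (ΣL-++ (g x) (concatMap g xs) f) (+-cong refl (ΣL-concatMap g xs f))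

  ΣL-cong : ∀ {A : Set} (xs : List A) {f g : A → Carrier} → (∀ a → f a ≈ g a) →
            sumList xs f ≈ sumList xs g
  ΣL-cong []       h = refl
  ΣL-cong (x ∷ xs) h = +-cong (h x) (ΣL-cong xs h)

  ΣL-*ˡ : ∀ {A : Set} (xs : List A) a (f : A → Carrier) → a * sumList xs f ≈ sumList xs (λ x → a * f x)
  ΣL-*ˡ []       a f = zeroʳ a
  ΣL-*ˡ (x ∷ xs) a f = trans (distribˡ a _ _) (+-cong refl (ΣL-*ˡ xs a f))

  ΣL-upTo : ∀ n (f : ℕ → Carrier) → sumList (upTo n) f ≈ sumBelow n f
  ΣL-upTo n f = applyUpTo n (λ i → i)
    where
    applyUpTo : ∀ n (g : ℕ → ℕ) → sumList (List.applyUpTo g n) f ≈ sumBelow n (f ∘ g)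
    applyUpTo zero    g = refl
    applyUpTo (suc n) g = trans (+-cong refl (applyUpTo n (g ∘ suc))) (sym (Σ-first n (f ∘ g)))

  natCast≡× : ∀ n → natCast n ≡ n × 1#
  natCast≡× zero    = P.refl
  natCast≡× (suc n) = P.cong (1# +_) (natCast≡× n)

  pow≡^ : ∀ x k → pow x k ≡ x ^ k
  pow≡^ x zero    = P.refl
  pow≡^ x (suc k) = P.cong (x *_) (pow≡^ x k)

  natCast-* : ∀ a b → natCast (a ℕ.* b) ≈ natCast a * natCast b
  natCast-* a b rewrite natCast≡× (a ℕ.* b) | natCast≡× a | natCast≡× b = ×1-homo-* a b

  pow-cong : ∀ {x y} k → x ≈ y → pow x k ≈ pow y k
  pow-cong {x} {y} k x≈y rewrite pow≡^ x k | pow≡^ y k = ^-congˡ k x≈y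

  pow-1 : ∀ k → pow 1# k ≈ 1#
  pow-1 zero    = refl
  pow-1 (suc k) = trans (*-identityˡ _) (pow-1 k)

  binomial : ∀ a b k → pow (a + b) k ≈
             sumBelow (suc k) (λ j → natCast (k C j) * (pow a j * pow b (k ∸ j)))
  binomial a b k = begin
    pow (a + b) k                      ≡⟨ pow≡^ (a + b) k ⟩
    (a + b) ^ k                        ≈⟨ Binomial.theorem k a b ⟩
    sum {suc k} (λ i → term (toℕ i))        ≈⟨ sym (sumBelow≈sum (suc k) term) ⟩
    sumBelow (suc k) term              ≈⟨ Σ-cong′ (suc k) as-natCast ⟩
    sumBelow (suc k) (λ j → natCast (k C j) * (pow a j * pow b (k ∸ j))) ∎
    where
    term : ℕ → Carrier
    term j = (k C j) × (a ^ j * b ^ (k ∸ j))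
    sumBelow≈sum : ∀ n (f : ℕ → Carrier) → sumBelow n f ≈ sum {n} (λ i → f (toℕ i))
    sumBelow≈sum zero    f = refl
    sumBelow≈sum (suc n) f = trans (Σ-first n f) (+-cong refl (sumBelow≈sum n (f ∘ suc)))
    as-natCast : ∀ j → term j ≈ natCast (k C j) * (pow a j * pow b (k ∸ j))
    as-natCast j rewrite natCast≡× (k C j) | pow≡^ a j | pow≡^ b (k ∸ j) =
      trans (×-congʳ (k C j) (sym (*-identityˡ _))) (sym (×-assoc-* (k C j) 1# _))

module Proof {c ℓ : Level} (R : CommutativeRing c ℓ) (F : IsCharZeroField R) where
  open CommutativeRing R
  open FieldOps R F
  open IsCharZeroField F using (_⁻¹; inverseʳ; charZero)
  open RingFacts R
  open import Relation.Binary.Reasoning.Setoid setoid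
  open import Algebra.Solver.Ring.NaturalCoefficients commutativeSemiring (λ _ _ → nothing)
    using (solve; _:+_; _:*_; _:=_; con)

  cancel-unit : ∀ {a u x y} → a * u ≈ 1# → a * x ≈ a * y → x ≈ y
  cancel-unit {a} {u} {x} {y} au≈1 ax≈ay = begin
    x             ≈⟨ sym (*-identityˡ x) ⟩
    1# * x        ≈⟨ *-cong (trans (sym au≈1) (*-comm a u)) refl ⟩
    (u * a) * x   ≈⟨ *-assoc u a x ⟩
    u * (a * x)   ≈⟨ *-cong refl ax≈ay ⟩
    u * (a * y)   ≈⟨ sym (*-assoc u a y) ⟩
    (u * a) * y   ≈⟨ *-cong (trans (*-comm u a) au≈1) refl ⟩
    1# * y        ≈⟨ *-identityˡ y ⟩
    y             ∎

  inverse-unique : ∀ {a u} → ¬ (a ≈ 0#) → a * u ≈ 1# → u ≈ a ⁻¹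
  inverse-unique {a} a≉0 au≈1 = cancel-unit au≈1 (trans au≈1 (sym (inverseʳ a a≉0)))

  *-nonzero : ∀ {a b} → ¬ (a ≈ 0#) → ¬ (b ≈ 0#) → ¬ (a * b ≈ 0#)
  *-nonzero {a} {b} a≉0 b≉0 ab≈0 = b≉0 (begin
    b                   ≈⟨ sym (*-identityˡ b) ⟩
    1# * b              ≈⟨ *-cong (sym (trans (*-comm _ _) (inverseʳ a a≉0))) refl ⟩
    (a ⁻¹ * a) * b      ≈⟨ *-assoc _ _ _ ⟩
    a ⁻¹ * (a * b)      ≈⟨ *-cong refl ab≈0 ⟩
    a ⁻¹ * 0#           ≈⟨ zeroʳ _ ⟩
    0#                  ∎)

  ⁻¹-* : ∀ {a b} → ¬ (a ≈ 0#) → ¬ (b ≈ 0#) → (a * b) ⁻¹ ≈ a ⁻¹ * b ⁻¹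
  ⁻¹-* {a} {b} a≉0 b≉0 = sym (inverse-unique (*-nonzero a≉0 b≉0) (begin
    (a * b) * (a ⁻¹ * b ⁻¹)     ≈⟨ solve 4 (λ a b u v → (a :* b) :* (u :* v) := (a :* u) :* (b :* v)) refl _ _ _ _ ⟩
    (a * a ⁻¹) * (b * b ⁻¹)     ≈⟨ *-cong (inverseʳ a a≉0) (inverseʳ b b≉0) ⟩
    1# * 1#                     ≈⟨ *-identityˡ 1# ⟩
    1#                          ∎))

  natCast-nonzero : ∀ m .{{_ : ℕ.NonZero m}} → ¬ (natCast m ≈ 0#)
  natCast-nonzero m m≈0 = charZero (ℕ.pred m) (trans (≡⇒≈ (P.cong natCast (NP.suc-pred m))) m≈0)

  factorial-nonzero : ∀ k → ¬ (natCast (k !) ≈ 0#)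
  factorial-nonzero k = natCast-nonzero (k !) {{NP._!≢0 k}}

  invFact : ℕ → Carrier
  invFact k = natCast (k !) ⁻¹

  factorial-inverse : ∀ k → natCast (k !) * invFact k ≈ 1#
  factorial-inverse k = inverseʳ _ (factorial-nonzero k)

  cancel-factorial : ∀ k x → x * (natCast (k !) * invFact k) ≈ x
  cancel-factorial k x = trans (*-cong refl (factorial-inverse k)) (*-identityʳ x)

  invFact-0 : invFact 0 ≈ 1#
  invFact-0 = sym (inverse-unique (factorial-nonzero 0) (trans (*-identityʳ _) (+-identityʳ 1#)))

  choose-factorials-cast : ∀ {k j} → j ≤ k → natCast (k C j) * (natCast (j !) * natCast ((k ∸ j) !)) ≈ natCast (k !)
  choose-factorials-cast {k} {j} j≤k = begin
    natCast (k C j) * (natCast (j !) * natCast ((k ∸ j) !))  ≈⟨ sym (trans (natCast-* (k C j) _) (*-cong refl (natCast-* (j !) _))) ⟩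
    natCast ((k C j) ℕ.* (j ! ℕ.* (k ∸ j) !))                ≡⟨ P.cong natCast (choose-factorials j≤k) ⟩
    natCast (k !)                                            ∎

  binomial-factorials : ∀ {k j} → j ≤ k → natCast (k C j) ≈ natCast (k !) * (invFact j * invFact (k ∸ j))
  binomial-factorials {k} {j} j≤k = begin
    natCast (k C j)
      ≈⟨ sym (trans (cancel-factorial (k ∸ j) _) (cancel-factorial j _)) ⟩
    natCast (k C j) * (natCast (j !) * invFact j) * (natCast ((k ∸ j) !) * invFact (k ∸ j))
      ≈⟨ solve 5 (λ c a u b v → c :* (a :* u) :* (b :* v) := (c :* (a :* b)) :* (u :* v)) refl _ _ _ _ _ ⟩
    (natCast (k C j) * (natCast (j !) * natCast ((k ∸ j) !))) * (invFact j * invFact (k ∸ j))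
      ≈⟨ *-cong (choose-factorials-cast j≤k) refl ⟩
    natCast (k !) * (invFact j * invFact (k ∸ j)) ∎

  infix 4 _≈S_
  _≈S_ : Series → Series → Set ℓ
  f ≈S g = ∀ n → f n ≈ g n

  _+S_ : Series → Series → Series
  (f +S g) n = f n + g n

  -S_ : Series → Series
  (-S f) n = - f n

  scaleS : Carrier → Series → Series
  scaleS s f n = s * f n

  mulS-cong : ∀ {f f′ g g′} → f ≈S f′ → g ≈S g′ → mulS f g ≈S mulS f′ g′
  mulS-cong f≈f′ g≈g′ n = Σ-cong′ (suc n) (λ i → *-cong (f≈f′ i) (g≈g′ (n ∸ i)))

  mulS-comm : ∀ f g → mulS f g ≈S mulS g f
  mulS-comm f g n = begin
    sumBelow (suc n) (λ i → f i * g (n ∸ i))             ≈⟨ Σ-reverse n _ ⟩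
    sumBelow (suc n) (λ i → f (n ∸ i) * g (n ∸ (n ∸ i))) ≈⟨ Σ-cong (suc n) (λ i i<sn →
         trans (*-comm _ _) (*-cong (≡⇒≈ (P.cong g (NP.m∸[m∸n]≡n (NP.≤-pred i<sn)))) refl)) ⟩
    sumBelow (suc n) (λ i → g i * f (n ∸ i))             ∎

  mulS-assoc : ∀ f g h → mulS (mulS f g) h ≈S mulS f (mulS g h)
  mulS-assoc f g h n = begin
    sumBelow (suc n) (λ k → sumBelow (suc k) (λ i → f i * g (k ∸ i)) * h (n ∸ k))
      ≈⟨ Σ-cong′ (suc n) (λ k → Σ-*ʳ (suc k) _ _) ⟩
    sumBelow (suc n) (λ k → sumBelow (suc k) (λ i → f i * g (k ∸ i) * h (n ∸ k)))
      ≈⟨ Σ-triangle n (λ i k → f i * g (k ∸ i) * h (n ∸ k)) ⟩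
    sumBelow (suc n) (λ i → sumBelow (suc (n ∸ i)) (λ j → f i * g ((i ℕ.+ j) ∸ i) * h (n ∸ (i ℕ.+ j))))
      ≈⟨ Σ-cong′ (suc n) (λ i → trans (Σ-cong′ (suc (n ∸ i)) (reindex i)) (sym (Σ-*ˡ (suc (n ∸ i)) _ _))) ⟩
    sumBelow (suc n) (λ i → f i * sumBelow (suc (n ∸ i)) (λ j → g j * h (n ∸ i ∸ j))) ∎
    where
    reindex : ∀ i j → f i * g ((i ℕ.+ j) ∸ i) * h (n ∸ (i ℕ.+ j)) ≈ f i * (g j * h (n ∸ i ∸ j))
    reindex i j = trans (*-assoc _ _ _)
      (*-cong refl (*-cong (≡⇒≈ (P.cong g (NP.m+n∸m≡n i j))) (≡⇒≈ (P.cong h (P.sym (NP.∸-+-assoc n i j))))))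

  mulS-distribʳ : ∀ f g h → mulS (g +S h) f ≈S (mulS g f +S mulS h f)
  mulS-distribʳ f g h n = trans (Σ-cong′ (suc n) (λ i → distribʳ _ _ _)) (Σ-+ (suc n) _ _)

  mulS-distribˡ : ∀ f g h → mulS f (g +S h) ≈S (mulS f g +S mulS f h)
  mulS-distribˡ f g h n = trans (Σ-cong′ (suc n) (λ i → distribˡ _ _ _)) (Σ-+ (suc n) _ _)

  mulS-identityˡ : ∀ f → mulS δ₀ f ≈S f
  mulS-identityˡ f n = begin
    sumBelow (suc n) (λ i → δ₀ i * f (n ∸ i))                ≈⟨ Σ-first n _ ⟩
    1# * f n + sumBelow n (λ i → 0# * f (n ∸ suc i))         ≈⟨ +-cong (*-identityˡ _) (Σ-zero n (λ i _ → zeroˡ _)) ⟩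
    f n + 0#                                                 ≈⟨ +-identityʳ _ ⟩
    f n                                                      ∎

  mulS-identityʳ : ∀ f → mulS f δ₀ ≈S f
  mulS-identityʳ f n = trans (mulS-comm f δ₀ n) (mulS-identityˡ f n)

  mulS-scaleˡ : ∀ s f g → mulS (scaleS s f) g ≈S scaleS s (mulS f g)
  mulS-scaleˡ s f g n = trans (Σ-cong′ (suc n) (λ i → *-assoc _ _ _)) (sym (Σ-*ˡ (suc n) s _))

  mulS-scaleʳ : ∀ s f g → mulS f (scaleS s g) ≈S scaleS s (mulS f g)
  mulS-scaleʳ s f g n =
    trans (mulS-comm f (scaleS s g) n) (trans (mulS-scaleˡ s g f n) (*-cong refl (mulS-comm g f n)))

  -- The formal power series over R form a commutative ring; this gives the
  -- binomial theorem for series from RingFacts.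
  seriesRing : CommutativeRing c ℓ
  seriesRing = record
    { Carrier = Series
    ; _≈_ = _≈S_
    ; _+_ = _+S_
    ; _*_ = mulS
    ; -_ = -S_
    ; 0# = λ _ → 0#
    ; 1# = δ₀
    ; isCommutativeRing = record
      { isRing = record
        { +-isAbelianGroup = record
          { isGroup = record
            { isMonoid = record
              { isSemigroup = record
                { isMagma = record
                  { isEquivalence = record
                    { refl = λ n → refl ; sym = λ p n → sym (p n) ; trans = λ p q n → trans (p n) (q n) }
                  ; ∙-cong = λ p q n → +-cong (p n) (q n) }
                ; assoc = λ f g h n → +-assoc (f n) (g n) (h n) }
              ; identity = (λ f n → +-identityˡ (f n)) , (λ f n → +-identityʳ (f n)) }
            ; inverse = (λ f n → -‿inverseˡ (f n)) , (λ f n → -‿inverseʳ (f n))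
            ; ⁻¹-cong = λ p n → -‿cong (p n) }
          ; comm = λ f g n → +-comm (f n) (g n) }
        ; *-cong = mulS-cong
        ; *-assoc = mulS-assoc
        ; *-identity = mulS-identityˡ , mulS-identityʳ
        ; distrib = mulS-distribˡ , mulS-distribʳ }
      ; *-comm = mulS-comm }
    }

  module Ser = RingOps seriesRing
  module SerFacts = RingFacts seriesRing

  powS≈pow : ∀ f k → Ser.pow f k ≈S powS f k
  powS≈pow f zero    n = refl
  powS≈pow f (suc k) n = mulS-cong {f} {f} {Ser.pow f k} {powS f k} (λ _ → refl) (powS≈pow f k) n

  coeff-sum : ∀ n (G : ℕ → Series) m → Ser.sumBelow n G m ≈ sumBelow n (λ i → G i m)
  coeff-sum zero    G m = refl
  coeff-sum (suc n) G m = +-cong (coeff-sum n G m) refl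

  coeff-natCast : ∀ k X m → mulS (Ser.natCast k) X m ≈ natCast k * X m
  coeff-natCast zero    X m = trans (Σ-zero (suc m) (λ i _ → zeroˡ _)) (sym (zeroˡ _))
  coeff-natCast (suc k) X m = begin
    mulS (δ₀ +S Ser.natCast k) X m              ≈⟨ mulS-distribʳ X δ₀ (Ser.natCast k) m ⟩
    mulS δ₀ X m + mulS (Ser.natCast k) X m      ≈⟨ +-cong (mulS-identityˡ X m) (coeff-natCast k X m) ⟩
    X m + natCast k * X m                       ≈⟨ solve 2 (λ x c → x :+ c :* x := (con 1 :+ c) :* x) refl _ _ ⟩
    (1# + natCast k) * X m                      ∎

  powS-cong : ∀ {f g} k → f ≈S g → powS f k ≈S powS g k
  powS-cong {f} {g} k f≈g n =
    trans (sym (powS≈pow f k n)) (trans (SerFacts.pow-cong {f} {g} k f≈g n) (powS≈pow g k n))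

  powS-scale : ∀ s f k → powS (scaleS s f) k ≈S scaleS (pow s k) (powS f k)
  powS-scale s f zero    n = sym (*-identityˡ _)
  powS-scale s f (suc k) n = begin
    mulS (scaleS s f) (powS (scaleS s f) k) n
      ≈⟨ mulS-cong {scaleS s f} {scaleS s f} {powS (scaleS s f) k} (λ _ → refl) (powS-scale s f k) n ⟩
    mulS (scaleS s f) (scaleS (pow s k) (powS f k)) n
      ≈⟨ mulS-scaleˡ s f (scaleS (pow s k) (powS f k)) n ⟩
    s * mulS f (scaleS (pow s k) (powS f k)) n
      ≈⟨ *-cong refl (mulS-scaleʳ (pow s k) f (powS f k) n) ⟩
    s * (pow s k * mulS f (powS f k) n)
      ≈⟨ sym (*-assoc _ _ _) ⟩
    (s * pow s k) * mulS f (powS f k) n ∎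

  VanishesBelow : ℕ → Series → Set ℓ
  VanishesBelow k f = ∀ i → i < k → f i ≈ 0#

  mulS-order : ∀ a b {f g : Series} → VanishesBelow a f → VanishesBelow b g →
               VanishesBelow (a ℕ.+ b) (mulS f g)
  mulS-order a b {f} {g} f<a g<b n n<a+b = Σ-zero (suc n) term
    where
    term : ∀ i → i < suc n → f i * g (n ∸ i) ≈ 0#
    term i i<sn with i NP.<? a
    ... | yes i<a = trans (*-cong (f<a i i<a) refl) (zeroˡ _)
    ... | no  i≮a = trans (*-cong refl (g<b (n ∸ i) n-i<b)) (zeroʳ _)
      where
      n-i<b : n ∸ i < b
      n-i<b = NP.+-cancelˡ-< i (n ∸ i) b (NP.≤-trans (s≤s (NP.≤-reflexive (NP.m+[n∸m]≡n (NP.≤-pred i<sn))))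
                                          (NP.≤-trans n<a+b (NP.+-monoˡ-≤ b (NP.≮⇒≥ i≮a))))

  powS-order : ∀ {f} → f 0 ≈ 0# → ∀ k → VanishesBelow k (powS f k)
  powS-order {f} f0≈0 (suc k) = mulS-order 1 k (λ { .0 (s≤s z≤n) → f0≈0 }) (powS-order f0≈0 k)

  -- Only the terms k ≤ m of exp f contribute to degree m, so the defining
  -- sum may be extended to any bound M ≥ m.
  expS-truncate : ∀ {f} → f 0 ≈ 0# → ∀ m M → m ≤ M →
                  expS f m ≈ sumBelow (suc M) (λ k → invFact k * powS f k m)
  expS-truncate {f} f0≈0 m M m≤M = sym (Σ-extend (suc m) (suc M) (s≤s m≤M)
    (λ k m<k _ → trans (*-cong refl (powS-order f0≈0 k m m<k)) (zeroʳ _)))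

  expS-cong : ∀ {f g} → f ≈S g → expS f ≈S expS g
  expS-cong f≈g n = Σ-cong′ (suc n) (λ k → *-cong refl (powS-cong k f≈g n))

  invFact-binomial : ∀ {k j} → j ≤ k → invFact k * natCast (k C j) ≈ invFact j * invFact (k ∸ j)
  invFact-binomial {k} {j} j≤k = begin
    invFact k * natCast (k C j)                        ≈⟨ *-cong refl (binomial-factorials j≤k) ⟩
    invFact k * (natCast (k !) * (invFact j * invFact (k ∸ j))) ≈⟨ sym (*-assoc _ _ _) ⟩
    (invFact k * natCast (k !)) * (invFact j * invFact (k ∸ j)) ≈⟨ *-cong (trans (*-comm _ _) (factorial-inverse k)) refl ⟩
    1# * (invFact j * invFact (k ∸ j))                 ≈⟨ *-identityˡ _ ⟩
    invFact j * invFact (k ∸ j)                        ∎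

  powS-binomial : ∀ f g k n → powS (f +S g) k n ≈
                  sumBelow (suc k) (λ j → natCast (k C j) * mulS (powS f j) (powS g (k ∸ j)) n)
  powS-binomial f g k n = begin
    powS (f +S g) k n
      ≈⟨ sym (powS≈pow (f +S g) k n) ⟩
    Ser.pow (f +S g) k n
      ≈⟨ SerFacts.binomial f g k n ⟩
    Ser.sumBelow (suc k) (λ j → mulS (Ser.natCast (k C j)) (mulS (Ser.pow f j) (Ser.pow g (k ∸ j)))) n
      ≈⟨ coeff-sum (suc k) _ n ⟩
    sumBelow (suc k) (λ j → mulS (Ser.natCast (k C j)) (mulS (Ser.pow f j) (Ser.pow g (k ∸ j))) n)
      ≈⟨ Σ-cong′ (suc k) (λ j → trans (coeff-natCast (k C j) (mulS (Ser.pow f j) (Ser.pow g (k ∸ j))) n) (*-cong refl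
           (mulS-cong {Ser.pow f j} {powS f j} {Ser.pow g (k ∸ j)} (powS≈pow f j) (powS≈pow g (k ∸ j)) n))) ⟩
    sumBelow (suc k) (λ j → natCast (k C j) * mulS (powS f j) (powS g (k ∸ j)) n) ∎

  -- Both sides of exp(f + g) = exp f · exp g equal, in degree n, the double sum
  --   Σ_{j,l ≤ n} [t^n] (f^j g^l) / (j! l!).
  expPairSum : Series → Series → ℕ → Carrier
  expPairSum f g n = sumBelow (suc n) (λ j → sumBelow (suc n) (λ l → pairTerm j l))
    where
    pairTerm : ℕ → ℕ → Carrier
    pairTerm j l = (invFact j * invFact l) * mulS (powS f j) (powS g l) n

  -- Left side: expand (f + g)^k binomially, then reindex the triangle j ≤ k ≤ n.
  expS-+-expand : ∀ {f g} → f 0 ≈ 0# → g 0 ≈ 0# → ∀ n → expS (f +S g) n ≈ expPairSum f g n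
  expS-+-expand {f} {g} f0≈0 g0≈0 n = begin
    sumBelow (suc n) (λ k → invFact k * powS (f +S g) k n)
      ≈⟨ Σ-cong′ (suc n) (λ k → trans (*-cong refl (powS-binomial f g k n)) (Σ-*ˡ (suc k) _ _)) ⟩
    sumBelow (suc n) (λ k → sumBelow (suc k) (λ j → invFact k * (natCast (k C j) * P j (k ∸ j))))
      ≈⟨ Σ-cong′ (suc n) (λ k → Σ-cong (suc k) (λ j j<sk →
           trans (sym (*-assoc _ _ _)) (*-cong (invFact-binomial (NP.≤-pred j<sk)) refl))) ⟩
    sumBelow (suc n) (λ k → sumBelow (suc k) (λ j → T j (k ∸ j)))
      ≈⟨ Σ-triangle n (λ j k → T j (k ∸ j)) ⟩
    sumBelow (suc n) (λ j → sumBelow (suc (n ∸ j)) (λ l → T j ((j ℕ.+ l) ∸ j)))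
      ≈⟨ Σ-cong′ (suc n) (λ j → Σ-cong′ (suc (n ∸ j)) (λ l → ≡⇒≈ (P.cong (T j) (NP.m+n∸m≡n j l)))) ⟩
    sumBelow (suc n) (λ j → sumBelow (suc (n ∸ j)) (λ l → T j l))
      ≈⟨ Σ-cong (suc n) (λ j j<sn → sym (Σ-extend (suc (n ∸ j)) (suc n) (s≤s (NP.m∸n≤m n j))
           (λ l n-j<l _ → trans (*-cong refl (high-degree j l (NP.≤-pred j<sn) n-j<l)) (zeroʳ _)))) ⟩
    expPairSum f g n ∎
    where
    P : ℕ → ℕ → Carrier
    P j l = mulS (powS f j) (powS g l) n
    T : ℕ → ℕ → Carrier
    T j l = (invFact j * invFact l) * P j l
    high-degree : ∀ j l → j ≤ n → n ∸ j < l → P j l ≈ 0#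
    high-degree j l j≤n n-j<l = mulS-order j l (powS-order f0≈0 j) (powS-order g0≈0 l) n
      (NP.≤-trans (s≤s (NP.≤-reflexive (P.sym (NP.m+[n∸m]≡n j≤n)))) (NP.+-monoʳ-< j n-j<l))

  -- Right side: expand each factor and sum over the degree split i last.
  expS-*-expand : ∀ {f g} → f 0 ≈ 0# → g 0 ≈ 0# → ∀ n → mulS (expS f) (expS g) n ≈ expPairSum f g n
  expS-*-expand {f} {g} f0≈0 g0≈0 n = begin
    sumBelow (suc n) (λ i → expS f i * expS g (n ∸ i))
      ≈⟨ Σ-cong (suc n) (λ i i<sn → *-cong (expS-truncate f0≈0 i n (NP.≤-pred i<sn))
                                           (expS-truncate g0≈0 (n ∸ i) n (NP.m∸n≤m n i))) ⟩
    sumBelow (suc n) (λ i → sumBelow (suc n) (λ j → invFact j * powS f j i) * sumBelow (suc n) (λ l → invFact l * powS g l (n ∸ i)))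
      ≈⟨ Σ-cong′ (suc n) (λ i → trans (Σ-*-Σ (suc n) (suc n) _ _) (Σ-cong′ (suc n) (λ j → Σ-cong′ (suc n) (λ l →
           solve 4 (λ a b c d → (a :* b) :* (c :* d) := (a :* c) :* (b :* d)) refl _ _ _ _)))) ⟩
    sumBelow (suc n) (λ i → sumBelow (suc n) (λ j → sumBelow (suc n) (λ l → U j l i)))
      ≈⟨ trans (Σ-swap (suc n) (suc n) _) (Σ-cong′ (suc n) (λ j → Σ-swap (suc n) (suc n) _)) ⟩
    sumBelow (suc n) (λ j → sumBelow (suc n) (λ l → sumBelow (suc n) (λ i → U j l i)))
      ≈⟨ Σ-cong′ (suc n) (λ j → Σ-cong′ (suc n) (λ l → sym (Σ-*ˡ (suc n) _ _))) ⟩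
    expPairSum f g n ∎
    where
    U : ℕ → ℕ → ℕ → Carrier
    U j l i = (invFact j * invFact l) * (powS f j i * powS g l (n ∸ i))

  expS-+ : ∀ {f g} → f 0 ≈ 0# → g 0 ≈ 0# → expS (f +S g) ≈S mulS (expS f) (expS g)
  expS-+ f0≈0 g0≈0 n = trans (expS-+-expand f0≈0 g0≈0 n) (sym (expS-*-expand f0≈0 g0≈0 n))

  expS-zero : expS (λ _ → 0#) ≈S δ₀
  expS-zero n = begin
    sumBelow (suc n) (λ k → invFact k * powS (λ _ → 0#) k n)
      ≈⟨ Σ-first n _ ⟩
    invFact 0 * δ₀ n + sumBelow n (λ k → invFact (suc k) * mulS (λ _ → 0#) (powS (λ _ → 0#) k) n)
      ≈⟨ +-cong (*-cong invFact-0 refl) (Σ-zero n (λ k _ → trans (*-cong refl (Σ-zero (suc n) (λ _ _ → zeroˡ _))) (zeroʳ _))) ⟩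
    1# * δ₀ n + 0#
      ≈⟨ trans (+-identityʳ _) (*-identityˡ _) ⟩
    δ₀ n ∎

  expS-pow : ∀ {f} → f 0 ≈ 0# → ∀ j → powS (expS f) j ≈S expS (scaleS (natCast j) f)
  expS-pow {f} f0≈0 zero    n = sym (trans (expS-cong (λ m → zeroˡ (f m)) n) (expS-zero n))
  expS-pow {f} f0≈0 (suc j) n = begin
    mulS (expS f) (powS (expS f) j) n
      ≈⟨ mulS-cong {expS f} {expS f} {powS (expS f) j} (λ _ → refl) (expS-pow f0≈0 j) n ⟩
    mulS (expS f) (expS (scaleS (natCast j) f)) n
      ≈⟨ sym (expS-+ f0≈0 (trans (*-cong refl f0≈0) (zeroʳ _)) n) ⟩
    expS (f +S scaleS (natCast j) f) n
      ≈⟨ expS-cong (λ m → solve 2 (λ x c → x :+ c :* x := (con 1 :+ c) :* x) refl _ _) n ⟩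
    expS (scaleS (natCast (suc j)) f) n ∎

  powS-t : ∀ k d → powS tS k (k ℕ.+ d) ≈ δ₀ d
  powS-t zero    d = refl
  powS-t (suc k) d = trans (shift (powS tS k) (k ℕ.+ d)) (powS-t k d)
    where
    shift : ∀ (X : Series) m → mulS tS X (suc m) ≈ X m
    shift X m = begin
      sumBelow (suc (suc m)) (λ i → tS i * X (suc m ∸ i))
        ≈⟨ trans (Σ-first (suc m) _) (+-cong refl (Σ-first m _)) ⟩
      0# * X (suc m) + (1# * X m + sumBelow m (λ i → 0# * X (m ∸ suc i)))
        ≈⟨ +-cong (zeroˡ _) (+-cong (*-identityˡ _) (Σ-zero m (λ _ _ → zeroˡ _))) ⟩
      0# + (X m + 0#)
        ≈⟨ trans (+-identityˡ _) (+-identityʳ _) ⟩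
      X m ∎

  expS-linear : ∀ β m → expS (scaleS β tS) m ≈ pow β m * invFact m
  expS-linear β m = begin
    sumBelow m term + term m   ≈⟨ +-cong (Σ-zero m below) top ⟩
    0# + pow β m * invFact m   ≈⟨ +-identityˡ _ ⟩
    pow β m * invFact m        ∎
    where
    term : ℕ → Carrier
    term k = invFact k * powS (scaleS β tS) k m
    term≈ : ∀ k → term k ≈ invFact k * (pow β k * powS tS k m)
    term≈ k = *-cong refl (powS-scale β tS k m)
    below : ∀ k → k < m → term k ≈ 0#
    below k k<m with NP.m≤n⇒∃[o]m+o≡n k<m
    ... | d , P.refl = trans (term≈ k) (trans (*-cong refl (*-cong refl
          (trans (≡⇒≈ (P.cong (powS tS k) (P.sym (NP.+-suc k d)))) (powS-t k (suc d))))) (trans (*-cong refl (zeroʳ _)) (zeroʳ _)))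
    top : term m ≈ pow β m * invFact m
    top = trans (term≈ m) (trans (*-cong refl (*-cong refl (trans (≡⇒≈ (P.cong (powS tS m) (P.sym (NP.+-identityʳ m)))) (powS-t m 0))))
            (solve 2 (λ a b → a :* (b :* con 1) := b :* a) refl _ _))

  -- e^t = exp(t), hence (e^t)^j = e^{jt} has coefficients j^r / r!.
  eT-pow : ∀ j r → powS eT j r ≈ pow (natCast j) r * invFact r
  eT-pow j r = begin
    powS eT j r                          ≈⟨ powS-cong j eT≈exp-t r ⟩
    powS (expS tS) j r                   ≈⟨ expS-pow {tS} refl j r ⟩
    expS (scaleS (natCast j) tS) r       ≈⟨ expS-linear (natCast j) r ⟩
    pow (natCast j) r * invFact r        ∎
    where
    eT≈exp-t : eT ≈S expS tS
    eT≈exp-t m = sym (begin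
      expS tS m                 ≈⟨ expS-cong (λ r → sym (*-identityˡ (tS r))) m ⟩
      expS (scaleS 1# tS) m     ≈⟨ expS-linear 1# m ⟩
      pow 1# m * invFact m      ≈⟨ trans (*-cong (pow-1 m) refl) (*-identityˡ _) ⟩
      invFact m                 ∎)

  -- The series 1 - e^t, written so that the binomial theorem expands its
  -- powers as Σ_j C(k,j) (-e^t)^j.
  oneMinusEt : Series
  oneMinusEt = scaleS (- 1#) eT +S δ₀

  oneMinusEt-0 : oneMinusEt 0 ≈ 0#
  oneMinusEt-0 = begin
    - 1# * invFact 0 + 1#   ≈⟨ +-cong (*-cong refl invFact-0) refl ⟩
    - 1# * 1# + 1#          ≈⟨ +-cong (*-identityʳ _) refl ⟩
    - 1# + 1#               ≈⟨ -‿inverseˡ 1# ⟩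
    0#                      ∎

  oneMinusEt-pow : ∀ k r → powS oneMinusEt k r ≈
                   sumBelow (suc k) (λ j → natCast (k C j) * (pow (- 1#) j * (pow (natCast j) r * invFact r)))
  oneMinusEt-pow k r = trans (powS-binomial (scaleS (- 1#) eT) δ₀ k r) (Σ-cong′ (suc k) (λ j → *-cong refl (begin
    mulS (powS (scaleS (- 1#) eT) j) (powS δ₀ (k ∸ j)) r
      ≈⟨ mulS-cong {powS (scaleS (- 1#) eT) j} (λ _ → refl) (δ₀-pow (k ∸ j)) r ⟩
    mulS (powS (scaleS (- 1#) eT) j) δ₀ r
      ≈⟨ mulS-identityʳ _ r ⟩
    powS (scaleS (- 1#) eT) j r
      ≈⟨ powS-scale (- 1#) eT j r ⟩
    pow (- 1#) j * powS eT j r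
      ≈⟨ *-cong refl (eT-pow j r) ⟩
    pow (- 1#) j * (pow (natCast j) r * invFact r) ∎)))
    where
    δ₀-pow : ∀ q → powS δ₀ q ≈S δ₀
    δ₀-pow q m = trans (sym (powS≈pow δ₀ q m)) (SerFacts.pow-1 q m)

  alternatingWeight : Carrier → ℕ → ℕ → Carrier
  alternatingWeight y k j = natCast (k C j) * (pow (- 1#) j * pow y k * invFact k)

  exp-oneMinusEt-coeff : ∀ y N r → r ≤ N →
    sumBelow (suc N) (λ k → sumBelow (suc k) (λ j → alternatingWeight y k j * pow (natCast j) r))
    ≈ natCast (r !) * expS (scaleS y oneMinusEt) r
  exp-oneMinusEt-coeff y N r r≤N = sym (begin
    natCast (r !) * expS (scaleS y oneMinusEt) r
      ≈⟨ *-cong refl (expS-truncate (trans (*-cong refl oneMinusEt-0) (zeroʳ y)) r N r≤N) ⟩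
    natCast (r !) * sumBelow (suc N) (λ k → invFact k * powS (scaleS y oneMinusEt) k r)
      ≈⟨ Σ-*ˡ (suc N) _ _ ⟩
    sumBelow (suc N) (λ k → natCast (r !) * (invFact k * powS (scaleS y oneMinusEt) k r))
      ≈⟨ Σ-cong′ (suc N) (λ k → *-cong refl (*-cong refl (trans (powS-scale y oneMinusEt k r) (*-cong refl (oneMinusEt-pow k r))))) ⟩
    sumBelow (suc N) (λ k → natCast (r !) * (invFact k * (pow y k * sumBelow (suc k) (term k))))
      ≈⟨ Σ-cong′ (suc N) (λ k → trans (*-cong refl (trans (*-cong refl (Σ-*ˡ (suc k) _ _)) (Σ-*ˡ (suc k) _ _))) (Σ-*ˡ (suc k) _ _)) ⟩
    sumBelow (suc N) (λ k → sumBelow (suc k) (λ j → natCast (r !) * (invFact k * (pow y k * term k j))))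
      ≈⟨ Σ-cong′ (suc N) (λ k → Σ-cong′ (suc k) (λ j → trans
           (solve 7 (λ f ik yk c s jr ir → f :* (ik :* (yk :* (c :* (s :* (jr :* ir)))))
                                        := (c :* (s :* yk :* ik) :* jr) :* (f :* ir)) refl _ _ _ _ _ _ _)
           (cancel-factorial r _))) ⟩
    sumBelow (suc N) (λ k → sumBelow (suc k) (λ j → alternatingWeight y k j * pow (natCast j) r)) ∎)
    where
    term : ℕ → ℕ → Carrier
    term k j = natCast (k C j) * (pow (- 1#) j * (pow (natCast j) r * invFact r))

  -- p! [t^p] (exp(y (1 - e^t)) e^{xt}) = Σ_{k ≤ N} Σ_{j ≤ k} C(k,j) (-1)^j (y^k / k!) (x + j)^p
  -- for p ≤ N: expand (x + j)^p binomially and use exp-oneMinusEt-coeff for each power j^r.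
  shifted-power-sum : ∀ x y N p → p ≤ N →
    sumBelow (suc N) (λ k → sumBelow (suc k) (λ j → alternatingWeight y k j * pow (x + natCast j) p))
    ≈ natCast (p !) * mulS (expS (scaleS y oneMinusEt)) (expS (scaleS x tS)) p
  shifted-power-sum x y N p p≤N = begin
    sumBelow (suc N) (λ k → sumBelow (suc k) (λ j → A k j * pow (x + natCast j) p))
      ≈⟨ Σ-cong′ (suc N) (λ k → Σ-cong′ (suc k) (λ j → trans
           (*-cong refl (trans (pow-cong p (+-comm x (natCast j))) (binomial (natCast j) x p))) (Σ-*ˡ (suc p) _ _))) ⟩
    sumBelow (suc N) (λ k → sumBelow (suc k) (λ j → sumBelow (suc p) (λ r → A k j * (natCast (p C r) * (pow (natCast j) r * pow x (p ∸ r))))))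
      ≈⟨ trans (Σ-cong′ (suc N) (λ k → Σ-swap (suc k) (suc p) _)) (Σ-swap (suc N) (suc p) _) ⟩
    sumBelow (suc p) (λ r → sumBelow (suc N) (λ k → sumBelow (suc k) (λ j → A k j * (natCast (p C r) * (pow (natCast j) r * pow x (p ∸ r))))))
      ≈⟨ Σ-cong′ (suc p) (λ r → trans (Σ-cong′ (suc N) (λ k → trans (Σ-cong′ (suc k) (λ j →
            solve 4 (λ a c jr xr → a :* (c :* (jr :* xr)) := (c :* xr) :* (a :* jr)) refl (A k j) _ _ _)) (sym (Σ-*ˡ (suc k) _ _))))
            (sym (Σ-*ˡ (suc N) _ _))) ⟩
    sumBelow (suc p) (λ r → (natCast (p C r) * pow x (p ∸ r)) * sumBelow (suc N) (λ k → sumBelow (suc k) (λ j → A k j * pow (natCast j) r)))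
      ≈⟨ Σ-cong (suc p) (λ r r<sp → *-cong refl (exp-oneMinusEt-coeff y N r (NP.≤-trans (NP.≤-pred r<sp) p≤N))) ⟩
    sumBelow (suc p) (λ r → (natCast (p C r) * pow x (p ∸ r)) * (natCast (r !) * Z r))
      ≈⟨ Σ-cong (suc p) (λ r r<sp → term r (NP.≤-pred r<sp)) ⟩
    sumBelow (suc p) (λ r → natCast (p !) * (Z r * X (p ∸ r)))
      ≈⟨ sym (Σ-*ˡ (suc p) _ _) ⟩
    natCast (p !) * mulS Z X p ∎
    where
    A : ℕ → ℕ → Carrier
    A = alternatingWeight y
    Z X : Series
    Z = expS (scaleS y oneMinusEt)
    X = expS (scaleS x tS)
    term : ∀ r → r ≤ p → (natCast (p C r) * pow x (p ∸ r)) * (natCast (r !) * Z r) ≈ natCast (p !) * (Z r * X (p ∸ r))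
    term r r≤p = begin
      (natCast (p C r) * pow x (p ∸ r)) * (natCast (r !) * Z r)
        ≈⟨ *-cong (*-cong (binomial-factorials r≤p) refl) refl ⟩
      ((natCast (p !) * (invFact r * invFact (p ∸ r))) * pow x (p ∸ r)) * (natCast (r !) * Z r)
        ≈⟨ solve 6 (λ f ir iq xq fr z → ((f :* (ir :* iq)) :* xq) :* (fr :* z) := (f :* (z :* (xq :* iq))) :* (fr :* ir)) refl _ _ _ _ _ _ ⟩
      (natCast (p !) * (Z r * (pow x (p ∸ r) * invFact (p ∸ r)))) * (natCast (r !) * invFact r)
        ≈⟨ cancel-factorial r _ ⟩
      natCast (p !) * (Z r * (pow x (p ∸ r) * invFact (p ∸ r)))
        ≈⟨ *-cong refl (*-cong refl (sym (expS-linear x (p ∸ r)))) ⟩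
      natCast (p !) * (Z r * X (p ∸ r)) ∎

  -- l₁! ⋯ lₙ!; it is nonzero, so multinomial coefficients are genuine quotients.
  factorials : ∀ {n} → Vec ℕ n → Carrier
  factorials ls = prodVec ls (λ l → natCast (l !))

  factorials-nonzero : ∀ {n} (ls : Vec ℕ n) → ¬ (factorials ls ≈ 0#)
  factorials-nonzero []       = IsCharZeroField.nontrivial F
  factorials-nonzero (l ∷ ls) = *-nonzero (factorial-nonzero l) (factorials-nonzero ls)

  multinomial-expansion : ∀ (G : Series) n m →
    sumList (tuples n m) (λ ls → multinomial m ls * prodVec ls (λ l → natCast (l !) * G l))
    ≈ natCast (m !) * powS G n m
  multinomial-expansion G zero    zero    = begin
    natCast 1 * (1# ⁻¹) * 1# + 0#   ≈⟨ trans (+-identityʳ _) (*-identityʳ _) ⟩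
    natCast 1 * (1# ⁻¹)             ≈⟨ *-cong refl (sym (inverse-unique (IsCharZeroField.nontrivial F) (*-identityˡ 1#))) ⟩
    natCast 1 * 1#                  ∎
  multinomial-expansion G zero    (suc m) = sym (zeroʳ _)
  multinomial-expansion G (suc n) m       = begin
    sumList (concatMap (λ l → List.map (l ∷_) (tuples n (m ∸ l))) (upTo (suc m))) (term m)
      ≈⟨ ΣL-concatMap (λ l → List.map (l ∷_) (tuples n (m ∸ l))) (upTo (suc m)) (term m) ⟩
    sumList (upTo (suc m)) (λ l → sumList (List.map (l ∷_) (tuples n (m ∸ l))) (term m))
      ≈⟨ ΣL-upTo (suc m) _ ⟩
    sumBelow (suc m) (λ l → sumList (List.map (l ∷_) (tuples n (m ∸ l))) (term m))
      ≈⟨ Σ-cong′ (suc m) (λ l → trans (ΣL-map (l ∷_) (tuples n (m ∸ l)) (term m))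
           (trans (ΣL-cong (tuples n (m ∸ l)) (split-first l)) (sym (ΣL-*ˡ (tuples n (m ∸ l)) _ _)))) ⟩
    sumBelow (suc m) (λ l → first l * sumList (tuples n (m ∸ l)) (term (m ∸ l)))
      ≈⟨ Σ-cong′ (suc m) (λ l → *-cong refl (multinomial-expansion G n (m ∸ l))) ⟩
    sumBelow (suc m) (λ l → first l * (natCast ((m ∸ l) !) * powS G n (m ∸ l)))
      ≈⟨ Σ-cong′ (suc m) (λ l → trans (solve 5 (λ f g i f′ p → (f :* g :* i) :* (f′ :* p) := (f :* (g :* p)) :* (f′ :* i)) refl _ _ _ _ _)
                                       (cancel-factorial (m ∸ l) _)) ⟩
    sumBelow (suc m) (λ l → natCast (m !) * (G l * powS G n (m ∸ l)))
      ≈⟨ sym (Σ-*ˡ (suc m) _ _) ⟩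
    natCast (m !) * mulS G (powS G n) m ∎
    where
    term : ℕ → ∀ {k} → Vec ℕ k → Carrier
    term m′ ls = multinomial m′ ls * prodVec ls (λ l → natCast (l !) * G l)
    first : ℕ → Carrier
    first l = natCast (m !) * G l * invFact (m ∸ l)
    split-first : ∀ l (ls : Vec ℕ n) → term m (l ∷ ls) ≈ first l * term (m ∸ l) ls
    split-first l ls = begin
      natCast (m !) * (natCast (l !) * factorials ls) ⁻¹ * (natCast (l !) * G l * Π)
        ≈⟨ *-cong (*-cong refl (⁻¹-* (factorial-nonzero l) (factorials-nonzero ls))) refl ⟩
      natCast (m !) * (invFact l * v) * (natCast (l !) * G l * Π)
        ≈⟨ solve 6 (λ f i v L g pa → f :* (i :* v) :* (L :* g :* pa) := (f :* g :* v :* pa) :* (L :* i)) refl _ _ _ _ _ _ ⟩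
      (natCast (m !) * G l * v * Π) * (natCast (l !) * invFact l)
        ≈⟨ cancel-factorial l _ ⟩
      natCast (m !) * G l * v * Π
        ≈⟨ sym (cancel-factorial (m ∸ l) _) ⟩
      (natCast (m !) * G l * v * Π) * (natCast ((m ∸ l) !) * invFact (m ∸ l))
        ≈⟨ solve 6 (λ f g v pa f′ i → (f :* g :* v :* pa) :* (f′ :* i) := (f :* g :* i) :* (f′ :* v :* pa)) refl _ _ _ _ _ _ ⟩
      first l * term (m ∸ l) ls ∎
      where
      v Π : Carrier
      v = factorials ls ⁻¹
      Π = prodVec ls (λ l → natCast (l !) * G l)

  exponential-convolution : ∀ f g N → natCast (N !) * mulS f g N ≈
    sumBelow (suc N) (λ m → natCast (N C m) * ((natCast (m !) * f m) * (natCast ((N ∸ m) !) * g (N ∸ m))))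
  exponential-convolution f g N = trans (Σ-*ˡ (suc N) _ _) (Σ-cong (suc N) (λ m m<sN → sym (begin
    natCast (N C m) * ((natCast (m !) * f m) * (natCast ((N ∸ m) !) * g (N ∸ m)))
      ≈⟨ solve 5 (λ c a x b y → c :* ((a :* x) :* (b :* y)) := (c :* (a :* b)) :* (x :* y)) refl _ _ _ _ _ ⟩
    (natCast (N C m) * (natCast (m !) * natCast ((N ∸ m) !))) * (f m * g (N ∸ m))
      ≈⟨ *-cong (choose-factorials-cast (NP.≤-pred m<sN)) refl ⟩
    natCast (N !) * (f m * g (N ∸ m)) ∎)))

  linear-exp-coefficient : ∀ β N → natCast (N !) * expS (scaleS β tS) N ≈ pow β N
  linear-exp-coefficient β N = begin
    natCast (N !) * expS (scaleS β tS) N     ≈⟨ *-cong refl (expS-linear β N) ⟩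
    natCast (N !) * (pow β N * invFact N)    ≈⟨ solve 3 (λ f p i → f :* (p :* i) := p :* (f :* i)) refl _ _ _ ⟩
    pow β N * (natCast (N !) * invFact N)    ≈⟨ cancel-factorial N _ ⟩
    pow β N                                  ∎

  exponent-identity : ∀ n b c x r →
    (scaleS n (actuarialExponent (- b) (- c)) +S (scaleS (n * c) oneMinusEt +S scaleS x tS)) r
    ≈ scaleS (x - b * n) tS r
  exponent-identity n b c x r = begin
    n * ((- b) * tS r + (- c) * (δ₀ r - eT r)) + ((n * c) * (- 1# * eT r + δ₀ r) + x * tS r)
      ≈⟨ +-cong (*-cong refl (+-cong (*-cong (neg b) refl) (*-cong (neg c) (+-cong refl (neg (eT r)))))) refl ⟩
    n * ((u * b) * tS r + (u * c) * (δ₀ r + u * eT r)) + ((n * c) * (u * eT r + δ₀ r) + x * tS r)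
      ≈⟨ solve 8 (λ n b c t d e u x → n :* ((u :* b) :* t :+ (u :* c) :* (d :+ u :* e)) :+ ((n :* c) :* (u :* e :+ d) :+ x :* t)
                                   := (x :+ u :* (b :* n)) :* t :+ ((n :* c) :* (d :+ u :* e)) :* (con 1 :+ u))
               refl n b c (tS r) (δ₀ r) (eT r) u x ⟩
    (x + u * (b * n)) * tS r + ((n * c) * (δ₀ r + u * eT r)) * (1# + u)
      ≈⟨ +-cong (*-cong (+-cong refl (sym (neg (b * n)))) refl) (trans (*-cong refl (-‿inverseʳ 1#)) (zeroʳ _)) ⟩
    (x - b * n) * tS r + 0#
      ≈⟨ +-identityʳ _ ⟩
    (x - b * n) * tS r ∎
    where
    open import Algebra.Properties.Ring ring using (-1*x≈-x)
    u : Carrier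
    u = - 1#
    neg : ∀ a → - a ≈ u * a
    neg a = sym (-1*x≈-x a)

  generating-function : ∀ n b c x →
    mulS (powS (expS (actuarialExponent (- b) (- c))) n)
         (mulS (expS (scaleS (natCast n * c) oneMinusEt)) (expS (scaleS x tS)))
    ≈S expS (scaleS (x - b * natCast n) tS)
  generating-function n b c x r = begin
    mulS (powS (expS E) n) (mulS (expS Y) (expS T)) r
      ≈⟨ mulS-cong {powS (expS E) n} (expS-pow E-0 n) (λ r → sym (expS-+ {Y} {T} Y-0 T-0 r)) r ⟩
    mulS (expS (scaleS nn E)) (expS (Y +S T)) r
      ≈⟨ sym (expS-+ {scaleS nn E} {Y +S T} (trans (*-cong refl E-0) (zeroʳ _)) (trans (+-cong Y-0 T-0) (+-identityʳ 0#)) r) ⟩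
    expS (scaleS nn E +S (Y +S T)) r
      ≈⟨ expS-cong (exponent-identity nn b c x) r ⟩
    expS (scaleS (x - b * nn) tS) r ∎
    where
    nn : Carrier
    nn = natCast n
    E Y T : Series
    E = actuarialExponent (- b) (- c)
    Y = scaleS (nn * c) oneMinusEt
    T = scaleS x tS
    E-0 : E 0 ≈ 0#
    E-0 = trans (+-cong (zeroʳ _) (*-cong refl (trans (+-cong refl (-‿cong invFact-0)) (-‿inverseʳ 1#))))
                (trans (+-identityˡ _) (zeroʳ _))
    Y-0 : Y 0 ≈ 0#
    Y-0 = trans (*-cong refl oneMinusEt-0) (zeroʳ _)
    T-0 : T 0 ≈ 0#
    T-0 = zeroʳ x

  rhs-factorised : ∀ N b c x → theorem3RHS (suc N) x b c ≈
    x * sumBelow (suc N) (λ m → binom N m *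
          (sumList (tuples (suc N) m) (λ ls → multinomial m ls * prodVec ls (λ l → actuarial l (- b) (- c)))
           * sumBelow (suc N) (λ k → sumBelow (suc k) (λ j →
               alternatingWeight (natCast (suc N) * c) k j * pow (x + natCast j) (N ∸ m)))))
  rhs-factorised N b c x = *-cong refl (Σ-cong′ (suc N) (λ m → begin
    sumList (tuples (suc N) m) (λ ls → sumBelow (suc N) (λ k → sumBelow (suc k) (λ j → summand m ls k j)))
      ≈⟨ ΣL-cong (tuples (suc N) m) (λ ls → split-summand m ls) ⟩
    sumList (tuples (suc N) m) (λ ls → (binom N m * h m ls) * Q m)
      ≈⟨ ΣL-cong (tuples (suc N) m) (λ ls → solve 3 (λ B h Q → (B :* h) :* Q := (B :* Q) :* h) refl _ _ _) ⟩
    sumList (tuples (suc N) m) (λ ls → (binom N m * Q m) * h m ls)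
      ≈⟨ sym (ΣL-*ˡ (tuples (suc N) m) _ _) ⟩
    (binom N m * Q m) * sumList (tuples (suc N) m) (h m)
      ≈⟨ solve 3 (λ B Q S → (B :* Q) :* S := B :* (S :* Q)) refl _ _ _ ⟩
    binom N m * (sumList (tuples (suc N) m) (h m) * Q m) ∎))
    where
    h : ℕ → Vec ℕ (suc N) → Carrier
    h m ls = multinomial m ls * prodVec ls (λ l → actuarial l (- b) (- c))
    A : ℕ → ℕ → ℕ → Carrier
    A m k j = alternatingWeight (natCast (suc N) * c) k j * pow (x + natCast j) (N ∸ m)
    Q : ℕ → Carrier
    Q m = sumBelow (suc N) (λ k → sumBelow (suc k) (A m k))
    summand : ℕ → Vec ℕ (suc N) → ℕ → ℕ → Carrier
    summand m ls k j = binom N m * multinomial m ls * binom k j * prodVec ls (λ l → actuarial l (- b) (- c))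
                       * (pow (- 1#) j * pow (natCast (suc N) * c) k * invFact k) * pow (x + natCast j) (N ∸ m)
    split-summand : ∀ m ls → sumBelow (suc N) (λ k → sumBelow (suc k) (summand m ls k)) ≈ (binom N m * h m ls) * Q m
    split-summand m ls = trans
      (Σ-cong′ (suc N) (λ k → trans (Σ-cong′ (suc k) (λ j →
         solve 6 (λ B M C PA s pw → B :* M :* C :* PA :* s :* pw := (B :* (M :* PA)) :* ((C :* s) :* pw)) refl _ _ _ _ _ _))
         (sym (Σ-*ˡ (suc k) _ _))))
      (sym (Σ-*ˡ (suc N) _ _))

-- Theorem 3.  With n = N + 1, both sides are x · N! [t^N] of the generating
-- function identity.
theorem3 : ∀ {c ℓ : Level} (R : CommutativeRing c ℓ) (F : IsCharZeroField R)
           (n : ℕ) → 1 ≤ n →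
           (b c x : CommutativeRing.Carrier R) →
           ¬ (CommutativeRing._≈_ R b (CommutativeRing.0# R)) →
           ¬ (CommutativeRing._≈_ R c (CommutativeRing.0# R)) →
           CommutativeRing._≈_ R (FieldOps.abel R F n x b) (FieldOps.theorem3RHS R F n x b c)
theorem3 R F (suc N) (s≤s z≤n) b c x _ _ = begin
  abel n x b
    ≈⟨ *-cong refl (sym (linear-exp-coefficient (x - b * natCast n) N)) ⟩
  x * (natCast (N !) * expS (scaleS (x - b * natCast n) tS) N)
    ≈⟨ *-cong refl (*-cong refl (sym (generating-function n b c x N))) ⟩
  x * (natCast (N !) * mulS (powS G n) (mulS Z X) N)
    ≈⟨ *-cong refl (exponential-convolution (powS G n) (mulS Z X) N) ⟩
  x * sumBelow n (λ m → binom N m * ((natCast (m !) * powS G n m) * (natCast ((N ∸ m) !) * mulS Z X (N ∸ m))))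
    ≈⟨ *-cong refl (Σ-cong′ n (λ m → *-cong refl (*-cong (sym (multinomial-expansion G n m))
                                                           (sym (shifted-power-sum x y N (N ∸ m) (NP.m∸n≤m N m)))))) ⟩
  x * sumBelow n (λ m → binom N m *
        (sumList (tuples n m) (λ ls → multinomial m ls * prodVec ls (λ l → actuarial l (- b) (- c)))
         * sumBelow n (λ k → sumBelow (suc k) (λ j → alternatingWeight y k j * pow (x + natCast j) (N ∸ m)))))
    ≈⟨ sym (rhs-factorised N b c x) ⟩
  theorem3RHS n x b c ∎
  where
  open CommutativeRing R
  open FieldOps R F
  open RingFacts R using (Σ-cong′)
  open Proof R F
  open import Relation.Binary.Reasoning.Setoid setoid
  n : ℕ
  n = suc N
  y : Carrier
  y = natCast n * c
  G Z X : Series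
  G = expS (actuarialExponent (- b) (- c))
  Z = expS (scaleS y oneMinusEt)
  X = expS (scaleS x tS)
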